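{- Let $\vec{a}=(a_1,\dots,a_n)$ be a non-decreasing sequence of positive integers and let $H\in\mathcal{H}_{\vec{a}}$. Let $\sigma_i$ be a moveable cell of $H$, and let $H'\in\mathcal{H}_{\vec{a}}$ be obtained from $H$ by moving $\sigma_i$ (with its number) by one row in its assigned direction. Then: (a) $\sigma_i$ is moveable in $H'$, in the direction opposite to the one it was moved in; (b) if $j\ne i$ and $\sigma_j$ is moveable in $H$, then $\sigma_j$ is moveable in $H'$ in the same direction; (c) if $\sigma_j$ is not moveable in $H$, then it is not moveable in $H'$.
   Context: $Y_{\vec{a}}$ is the Young diagram with columns numbered $1,\dots,n$ from left to right and rows numbered from top to bottom, where column $c$ consists of the cells in rows $1,\dots,a_{n+1-c}$. A horizontal strip $H$ in $Y_{\vec{a}}$ is a set of cells of $Y_{\vec{a}}$ containing exactly one cell $\sigma_i$ in each column $i\in[n]$, such that for $i<j$ the cell $\sigma_i$ is in the same row as or a lower row than $\sigma_j$ (i.e. $r(\sigma_i)\ge r(\sigma_j)$, where $r(\sigma)$ is the row number of $\sigma$). A proper filling of $H$ writes the numbers $1,\dots,n$ bijectively into its cells so that within each row $r$ the numbers increase from left to right if $r$ is odd and decrease from left to right if $r$ is even; $\sigma_i$ also denotes the number written in the cell in column $i$. $\mathcal{H}_{\vec{a}}$ is the set of properly filled horizontal strips in $Y_{\vec{a}}$. For $H\in\mathcal{H}_{\vec{a}}$, adjoin an imaginary cell $\sigma_{n+1}=n+1$ in row $1$, column $n+1$, and set $\epsilon_i=\operatorname{sgn}(\sigma_i-\sigma_{i+1})(-1)^{r(\sigma_i)}$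 for $i\in[n]$. The assigned direction of $\sigma_i$ is up if $\epsilon_i=-1$ and down if $\epsilon_i=1$. $\sigma_i$ is moveable up if its assigned direction is up (moving it up means moving it to the cell immediately above, one row higher). $\sigma_i$ is moveable down if its assigned direction is down, $\sigma_i$ is not the bottom cell of column $i$, and moving $\sigma_i$ (with its number) to the cell immediately below it again yields an element of $\mathcal{H}_{\vec{a}}$. -}

module Defs where

open import Data.Nat using (ℕ; zero; suc; _+_; _∸_; _≤_; _<_)
open import Data.Fin using (Fin; zero; suc; toℕ; opposite; _≟_)
open import Data.Integer as ℤ using (ℤ; +_; -[1+_]; 0ℤ; 1ℤ; -1ℤ; _-_; _*_)
open import Data.Product using (Σ; _×_; ∃; ∃-syntax; _,_)
open import Data.Sum using (_⊎_)
open import Relation.Nullary using (¬_; yes; no)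
open import Relation.Binary.PropositionalEquality using (_≡_)

-- Columns are indexed by i : Fin n, column i ↔ paper's column (toℕ i + 1).
-- Rows are natural numbers starting at 1 (row 1 = top).

NonDecreasing : ∀ {n} → (Fin n → ℕ) → Set
NonDecreasing {n} a = ∀ (k l : Fin n) → toℕ k ≤ toℕ l → a k ≤ a l

Positive : ∀ {n} → (Fin n → ℕ) → Set
Positive a = ∀ k → 1 ≤ a k

-- height of column c (paper) is a_{n+1-c}; for 0-based column i this is a (opposite i)
height : ∀ {n} → (Fin n → ℕ) → Fin n → ℕ
height a i = a (opposite i)

-- A filled strip candidate: the row of the cell σ_i and the number written in it.
record Strip (n : ℕ) : Set where
  constructor strip
  field
    row : Fin n → ℕ
    num : Fin n → ℕ
open Strip public

data Parity : Set where
  oddP evenP : Parity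

parity : ℕ → Parity
parity zero = evenP
parity (suc zero) = oddP
parity (suc (suc r)) = parity r

record Valid {n : ℕ} (a : Fin n → ℕ) (H : Strip n) : Set where
  field
    row-pos    : ∀ i → 1 ≤ row H i
    row-bound  : ∀ i → row H i ≤ height a i
    row-mono   : ∀ i j → toℕ i < toℕ j → row H j ≤ row H i
    num-range  : ∀ i → 1 ≤ num H i × num H i ≤ n
    num-inj    : ∀ i j → num H i ≡ num H j → i ≡ j
    num-surj   : ∀ k → 1 ≤ k → k ≤ n → ∃[ i ] num H i ≡ k
    fill-odd   : ∀ i j → toℕ i < toℕ j → row H i ≡ row H j →
                 parity (row H i) ≡ oddP → num H i < num H j
    fill-even  : ∀ i j → toℕ i < toℕ j → row H i ≡ row H j →
                 parity (row H i) ≡ evenP → num H j < num H i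

-- value of f at column i+1, with default d for the imaginary column n+1
nextVal : ∀ {n} → (Fin n → ℕ) → ℕ → Fin n → ℕ
nextVal {suc zero} f d zero = d
nextVal {suc (suc n)} f d zero = f (suc zero)
nextVal {suc (suc n)} f d (suc i) = nextVal (λ k → f (suc k)) d i

sgn : ℤ → ℤ
sgn (+ zero) = 0ℤ
sgn (+ suc _) = 1ℤ
sgn -[1+ _ ] = -1ℤ

negOnePow : ℕ → ℤ
negOnePow zero = 1ℤ
negOnePow (suc r) = ℤ.- negOnePow r

-- ε_i = sgn(σ_i − σ_{i+1}) (−1)^{r(σ_i)}, with σ_{n+1} = n+1
ε : ∀ {n} → Strip n → Fin n → ℤ
ε {n} H i = sgn (+ num H i - + nextVal (num H) (suc n) i) * negOnePow (row H i)

data Dir : Set where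
  up down : Dir

oppDir : Dir → Dir
oppDir up = down
oppDir down = up

moveRow : Dir → ℕ → ℕ
moveRow up r = r ∸ 1
moveRow down r = suc r

move : ∀ {n} → Dir → Strip n → Fin n → Strip n
move d H i = strip (λ j → f j (j ≟ i)) (num H)
  where
  f : ∀ j → _ → ℕ
  f j (yes _) = moveRow d (row H j)
  f j (no _)  = row H j

MoveableIn : ∀ {n} → (Fin n → ℕ) → Strip n → Fin n → Dir → Set
MoveableIn a H i up = ε H i ≡ -1ℤ
MoveableIn a H i down = ε H i ≡ 1ℤ × row H i < height a i × Valid a (move down H i)

Moveable : ∀ {n} → (Fin n → ℕ) → Strip n → Fin n → Set
Moveable a H i = ∃[ d ] MoveableIn a H i d

module Submission where

-- The proof rests on one reformulation of validity: for cells p < q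
-- (column-wise) the cell (row, number) of p must "precede" that of q —
-- q is not lower, and on a common row the numbers follow the row's parity
-- order.  Precedence is transitive, so a row assignment that agrees with
-- one valid strip off column j and with another valid strip off column i
-- is valid as soon as the single pair {i, j} is in order, and that only
-- needs checking when i and j are adjacent columns (otherwise chain through
-- a column strictly between them).  For adjacent columns the sign εᵢ says
-- exactly how the numbers σᵢ, σᵢ₊₁ compare relative to the parity of row
-- r(σᵢ), which settles the pair by elementary arithmetic on rows.
--
-- Parts (b) and (c) then follow because εⱼ only depends on the row of σⱼ
-- (unchanged for j ≠ i), and validity of "H′ with σⱼ sunk" and of "H with
-- σⱼ sunk" determine each other by the splicing argument above.  Part (a)
-- holds because moving σᵢ by one row flips the sign of εᵢ.

open import Defs
open import Data.Nat using (ℕ; zero; suc; _∸_; _≤_; _<_; z≤n; s≤s)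
open import Data.Nat.Properties
  using (≤-trans; ≤-antisym; <-trans; <-irrefl; ≤-<-trans; <⇒≤; n≤1+n; m∸n≤m; m≤n⇒m<n∨m≡n)
import Data.Nat.Properties as ℕ
open import Data.Fin using (Fin; zero; suc; toℕ; fromℕ<; _≟_)
open import Data.Fin.Properties using (toℕ-fromℕ<; toℕ<n)
open import Data.Integer using (ℤ; +_; 1ℤ; -1ℤ; -_; _-_; _*_; _⊖_)
open import Data.Integer.Properties
  using (*-identityʳ; neg-distribʳ-*; neg-involutive; [1+m]⊖[1+n]≡m⊖n; [+m]-[+n]≡m⊖n)
open import Data.Product using (_×_; _,_; ∃-syntax)
open import Data.Sum using (inj₁; inj₂)
open import Data.Empty using (⊥; ⊥-elim)
open import Relation.Nullary using (¬_; yes; no)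
open import Relation.Binary.PropositionalEquality
  using (_≡_; _≢_; refl; sym; trans; cong; subst)

InOrder : Parity → ℕ → ℕ → Set
InOrder oddP  s t = s < t
InOrder evenP s t = t < s

Ordered : ℕ → ℕ → ℕ → Set
Ordered r s t = InOrder (parity r) s t

ordered-trans : ∀ r {s t u} → Ordered r s t → Ordered r t u → Ordered r s u
ordered-trans r = go (parity r)
  where
  go : ∀ p {s t u} → InOrder p s t → InOrder p t u → InOrder p s u
  go oddP  s<t t<u = <-trans s<t t<u
  go evenP t<s u<t = <-trans u<t t<s

ordered-asym : ∀ r {s t} → Ordered r s t → Ordered r t s → ⊥
ordered-asym r = go (parity r)
  where
  go : ∀ p {s t} → InOrder p s t → InOrder p t s → ⊥
  go oddP  s<t t<s = <-irrefl refl (<-trans s<t t<s)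
  go evenP t<s s<t = <-irrefl refl (<-trans s<t t<s)

ordered-suc⁺ : ∀ r {s t} → Ordered r t s → Ordered (suc r) s t
ordered-suc⁺ zero          o = o
ordered-suc⁺ (suc zero)    o = o
ordered-suc⁺ (suc (suc r)) o = ordered-suc⁺ r o

ordered-suc⁻ : ∀ r {s t} → Ordered (suc r) s t → Ordered r t s
ordered-suc⁻ zero          o = o
ordered-suc⁻ (suc zero)    o = o
ordered-suc⁻ (suc (suc r)) o = ordered-suc⁻ r o

-- The value of ε selecting each direction, and the order it encodes between
-- σᵢ (number s in row r) and its right neighbour (number t).
assignedSign : Dir → ℤ
assignedSign up   = -1ℤ
assignedSign down = 1ℤ

AssignedOrder : Dir → ℕ → ℕ → ℕ → Set
AssignedOrder up   r s t = Ordered r t s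
AssignedOrder down r s t = Ordered r s t

sgn-⊖-pos : ∀ s t → sgn (s ⊖ t) ≡ 1ℤ → t < s
sgn-⊖-pos zero    zero    ()
sgn-⊖-pos zero    (suc t) ()
sgn-⊖-pos (suc s) zero    _ = s≤s z≤n
sgn-⊖-pos (suc s) (suc t) e = s≤s (sgn-⊖-pos s t (trans (cong sgn (sym ([1+m]⊖[1+n]≡m⊖n s t))) e))

sgn-⊖-neg : ∀ s t → sgn (s ⊖ t) ≡ -1ℤ → s < t
sgn-⊖-neg zero    zero    ()
sgn-⊖-neg zero    (suc t) _ = s≤s z≤n
sgn-⊖-neg (suc s) zero    ()
sgn-⊖-neg (suc s) (suc t) e = s≤s (sgn-⊖-neg s t (trans (cong sgn (sym ([1+m]⊖[1+n]≡m⊖n s t))) e))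

sign-succ : ∀ x r {u} → x * negOnePow r ≡ u → x * negOnePow (suc r) ≡ - u
sign-succ x r e = trans (sym (neg-distribʳ-* x (negOnePow r))) (cong -_ e)

sign-pred : ∀ x r {u} → x * negOnePow (suc r) ≡ u → x * negOnePow r ≡ - u
sign-pred x r e =
  trans (sym (neg-involutive _)) (cong -_ (trans (neg-distribʳ-* x (negOnePow r)) e))

ordered-of-sign : ∀ d r s t → sgn (+ s - + t) * negOnePow r ≡ assignedSign d →
                  AssignedOrder d r s t
ordered-of-sign up zero s t e =
  sgn-⊖-neg s t (trans (cong sgn (sym ([+m]-[+n]≡m⊖n s t))) (trans (sym (*-identityʳ _)) e))
ordered-of-sign down zero s t e =
  sgn-⊖-pos s t (trans (cong sgn (sym ([+m]-[+n]≡m⊖n s t))) (trans (sym (*-identityʳ _)) e))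
ordered-of-sign up   (suc r) s t e = ordered-suc⁺ r (ordered-of-sign down r s t (sign-pred (sgn (+ s - + t)) r e))
ordered-of-sign down (suc r) s t e = ordered-suc⁺ r (ordered-of-sign up r s t (sign-pred (sgn (+ s - + t)) r e))

-- Cell (r, s) may stand in a column left of cell (r′, s′).
Precedes : ℕ → ℕ → ℕ → ℕ → Set
Precedes r s r′ s′ = r′ ≤ r × (r ≡ r′ → Ordered r s s′)

precedes-strict : ∀ {r s r′ s′} → r′ < r → Precedes r s r′ s′
precedes-strict r′<r = <⇒≤ r′<r , λ { refl → ⊥-elim (<-irrefl refl r′<r) }

precedes-trans : ∀ {r s r′ s′ r″ s″} →
                 Precedes r s r′ s′ → Precedes r′ s′ r″ s″ → Precedes r s r″ s″
precedes-trans {r} {s} {r″ = r″} {s″} (r′≤r , o) (r″≤r′ , o′) = ≤-trans r″≤r′ r′≤r , same-row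
  where
  same-row : r ≡ r″ → Ordered r s s″
  same-row refl with ≤-antisym r′≤r r″≤r′
  ... | refl = ordered-trans r (o refl) (o′ refl)

precedes-lowerˡ : ∀ {r r̂ s q t} → r ≤ r̂ → Precedes r s q t → Precedes r̂ s q t
precedes-lowerˡ r≤r̂ (q≤r , o) with m≤n⇒m<n∨m≡n r≤r̂
... | inj₁ r<r̂ = precedes-strict (≤-<-trans q≤r r<r̂)
... | inj₂ refl = q≤r , o

-- Adjacent columns i, i+1 with the numbers of σᵢ, σᵢ₊₁ in the order assigned
-- to direction d: moving σᵢ in direction d is compatible with sinking σᵢ₊₁,
-- in both orders of performing the two moves.
adjacent-after : ∀ d {r s q t} → AssignedOrder d r s t →
                 Precedes r s (suc q) t → Precedes (moveRow d r) s (suc q) t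
adjacent-after down {r} _ c = precedes-lowerˡ (n≤1+n r) c
adjacent-after up {r} o (q<r , same) with m≤n⇒m<n∨m≡n q<r
adjacent-after up {suc r} o (_ , _) | inj₁ (s≤s q<r) = q<r , λ _ → ordered-suc⁻ r o
adjacent-after up {r} o (_ , same)  | inj₂ refl = ⊥-elim (ordered-asym r (same refl) o)

adjacent-before : ∀ d {r s q t} → AssignedOrder d r s t → Precedes r s q t →
                  Precedes (moveRow d r) s (suc q) t → Precedes r s (suc q) t
adjacent-before up {r} _ _ c = precedes-lowerˡ (m∸n≤m r 1) c
adjacent-before down {r} o (q≤r , _) (_ , same) with m≤n⇒m<n∨m≡n q≤r
... | inj₁ q<r = q<r , λ _ → o
... | inj₂ refl = ⊥-elim (ordered-asym r o (ordered-suc⁻ r (same refl)))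

Adjacent : ∀ {n} → Fin n → Fin n → Set
Adjacent p q = toℕ q ≡ suc (toℕ p)

adjacent⇒< : ∀ {n} {p q : Fin n} → Adjacent p q → toℕ p < toℕ q
adjacent⇒< adj = subst (_ <_) (sym adj) ℕ.≤-refl

<⇒≢ : ∀ {n} {p q : Fin n} → toℕ p < toℕ q → p ≢ q
<⇒≢ p<q refl = <-irrefl refl p<q

between : ∀ {n} {p q : Fin n} → toℕ p < toℕ q → ¬ Adjacent p q →
          ∃[ k ] (toℕ p < toℕ k × toℕ k < toℕ q)
between {n} {p} {q} p<q ¬adj with m≤n⇒m<n∨m≡n p<q
... | inj₂ adj = ⊥-elim (¬adj (sym adj))
... | inj₁ p+1<q = k , subst (toℕ p <_) (sym k≡p+1) ℕ.≤-refl , subst (_< toℕ q) (sym k≡p+1) p+1<q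
  where
  k : Fin n
  k = fromℕ< (<-trans p+1<q (toℕ<n q))
  k≡p+1 : toℕ k ≡ suc (toℕ p)
  k≡p+1 = toℕ-fromℕ< (<-trans p+1<q (toℕ<n q))

nextVal-adjacent : ∀ {n} (f : Fin n → ℕ) x {p q : Fin n} → Adjacent p q → nextVal f x p ≡ f q
nextVal-adjacent {suc zero}    f x {zero}  {zero}        ()
nextVal-adjacent {suc (suc n)} f x {zero}  {zero}        ()
nextVal-adjacent {suc (suc n)} f x {zero}  {suc zero}    refl = refl
nextVal-adjacent {suc (suc n)} f x {zero}  {suc (suc q)} ()
nextVal-adjacent {suc (suc n)} f x {suc p} {zero}        ()
nextVal-adjacent {suc (suc n)} f x {suc p} {suc q} adj =
  nextVal-adjacent (λ k → f (suc k)) x (ℕ.suc-injective adj)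

Consistent : ∀ {n} → (Fin n → ℕ) → (Fin n → ℕ) → Set
Consistent R N = ∀ p q → toℕ p < toℕ q → Precedes (R p) (N p) (R q) (N q)

valid⇒consistent : ∀ {n} {a : Fin n → ℕ} {H : Strip n} → Valid a H → Consistent (row H) (num H)
valid⇒consistent {H = H} V p q p<q =
  Valid.row-mono V p q p<q , λ same → in-order (row H p) (Valid.fill-odd V p q p<q same) (Valid.fill-even V p q p<q same)
  where
  in-order : ∀ r {s t} → (parity r ≡ oddP → s < t) → (parity r ≡ evenP → t < s) → Ordered r s t
  in-order r odd even with parity r
  ... | oddP  = odd refl
  ... | evenP = even refl

consistent⇒valid : ∀ {n} {a : Fin n → ℕ} {A R N : Fin n → ℕ} → Valid a (strip A N) →
                   (∀ k → 1 ≤ R k) → (∀ k → R k ≤ height a k) → Consistent R N →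
                   Valid a (strip R N)
consistent⇒valid V pos bound c = record
  { row-pos = pos ; row-bound = bound
  ; row-mono = λ p q p<q → let (q≤p , _) = c p q p<q in q≤p
  ; num-range = Valid.num-range V ; num-inj = Valid.num-inj V ; num-surj = Valid.num-surj V
  ; fill-odd = λ p q p<q same → odd (let (_ , o) = c p q p<q in o same)
  ; fill-even = λ p q p<q same → even (let (_ , o) = c p q p<q in o same)
  }
  where
  odd : ∀ {p s t} → InOrder p s t → p ≡ oddP → s < t
  odd o refl = o
  even : ∀ {p s t} → InOrder p s t → p ≡ evenP → t < s
  even o refl = o

valid-resp-rows : ∀ {n} {a : Fin n → ℕ} {H : Strip n} {R : Fin n → ℕ} →
                  (∀ k → R k ≡ row H k) → Valid a H → Valid a (strip R (num H))
valid-resp-rows {R = R} R≡ V =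
  consistent⇒valid V (λ k → subst (1 ≤_) (sym (R≡ k)) (Valid.row-pos V k))
    (λ k → subst (_≤ _) (sym (R≡ k)) (Valid.row-bound V k)) consistent
  where
  consistent : Consistent R _
  consistent p q p<q rewrite R≡ p | R≡ q = valid⇒consistent V p q p<q

consistent-at : ∀ {n} {R N : Fin n → ℕ} → Consistent R N → ∀ p q → toℕ p < toℕ q →
                ∀ {x y} → R p ≡ x → R q ≡ y → Precedes x (N p) y (N q)
consistent-at c p q p<q refl refl = c p q p<q

from-rows : ∀ {n} {N : Fin n → ℕ} (R : Fin n → ℕ) (p q : Fin n) {x y} → R p ≡ x → R q ≡ y →
            Precedes x (N p) y (N q) → Precedes (R p) (N p) (R q) (N q)
from-rows R p q refl refl c = c

-- R agrees with X away from q and with Y away from p: then p precedes q in R,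
-- by chaining through an intermediate column unless p, q are adjacent.
precedes-spliced : ∀ {n} {X Y R N : Fin n → ℕ} {p q : Fin n} →
                   Consistent X N → Consistent Y N →
                   (∀ k → k ≢ q → R k ≡ X k) → (∀ k → k ≢ p → R k ≡ Y k) →
                   (Adjacent p q → Precedes (R p) (N p) (R q) (N q)) →
                   toℕ p < toℕ q → Precedes (R p) (N p) (R q) (N q)
precedes-spliced {X = X} {Y} {R} {p = p} {q} cX cY R≡X R≡Y adjacent p<q with toℕ q ℕ.≟ suc (toℕ p)
... | yes adj = adjacent adj
... | no ¬adj with between p<q ¬adj
... | k , p<k , k<q =
  from-rows R p q (R≡X p (<⇒≢ p<q)) (R≡Y q (λ e → <⇒≢ p<q (sym e)))
    (precedes-trans (cX p k p<k) (subst (λ r → Precedes r _ _ _) (sym Xk≡Yk) (cY k q k<q)))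
  where
  Xk≡Yk : X k ≡ Y k
  Xk≡Yk = trans (sym (R≡X k (<⇒≢ k<q))) (R≡Y k (λ e → <⇒≢ p<k (sym e)))

valid-spliced : ∀ {n} {a : Fin n → ℕ} {A B R N : Fin n → ℕ} {i j : Fin n} → i ≢ j →
                (∀ k → k ≢ j → R k ≡ A k) → (∀ k → k ≢ i → R k ≡ B k) →
                Valid a (strip A N) → Valid a (strip B N) →
                (Adjacent i j → Precedes (R i) (N i) (R j) (N j)) →
                (Adjacent j i → Precedes (R j) (N j) (R i) (N i)) →
                Valid a (strip R N)
valid-spliced {a = a} {A} {B} {R} {N} {i} {j} i≢j R≡A R≡B VA VB adj-ij adj-ji =
  consistent⇒valid VA (spliced {λ _ r → 1 ≤ r} (Valid.row-pos VA) (Valid.row-pos VB))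
    (spliced {λ k r → r ≤ height a k} (Valid.row-bound VA) (Valid.row-bound VB)) consistent
  where
  spliced : {P : Fin _ → ℕ → Set} → (∀ k → P k (A k)) → (∀ k → P k (B k)) → ∀ k → P k (R k)
  spliced {P} PA PB k with k ≟ i
  ... | yes refl = subst (P k) (sym (R≡A k i≢j)) (PA k)
  ... | no k≢i   = subst (P k) (sym (R≡B k k≢i)) (PB k)
  cA : Consistent A N
  cA = valid⇒consistent VA
  cB : Consistent B N
  cB = valid⇒consistent VB
  consistent : Consistent R N
  consistent p q p<q with p ≟ j | q ≟ j
  ... | no p≢j   | no q≢j   = from-rows R p q (R≡A p p≢j) (R≡A q q≢j) (cA p q p<q)
  ... | yes refl | yes refl = ⊥-elim (<-irrefl refl p<q)
  ... | yes refl | no q≢j with q ≟ i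
  ...   | yes refl = precedes-spliced cB cA R≡B R≡A adj-ji p<q
  ...   | no q≢i   = from-rows R j q (R≡B j (λ e → i≢j (sym e))) (R≡B q q≢i) (cB j q p<q)
  consistent p q p<q | no p≢j | yes refl with p ≟ i
  ...   | yes refl = precedes-spliced cA cB R≡A R≡B adj-ij p<q
  ...   | no p≢i   = from-rows R p j (R≡B p p≢i) (R≡B j (λ e → i≢j (sym e))) (cB p j p<q)

row-move-self : ∀ {n} d (H : Strip n) i → row (move d H i) i ≡ moveRow d (row H i)
row-move-self d H i with i ≟ i
... | yes _  = refl
... | no i≢i = ⊥-elim (i≢i refl)

row-move-other : ∀ {n} d (H : Strip n) i k → k ≢ i → row (move d H i) k ≡ row H k
row-move-other d H i k k≢i with k ≟ i
... | yes k≡i = ⊥-elim (k≢i k≡i)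
... | no _    = refl

row-move-commute : ∀ {n} d (H : Strip n) i j k → k ≢ i →
                   row (move down (move d H i) j) k ≡ row (move down H j) k
row-move-commute d H i j k k≢i with k ≟ j
... | yes _ = cong suc (row-move-other d H i k k≢i)
... | no _  = row-move-other d H i k k≢i

-- Raising σᵢ and sinking it again restores H (σᵢ is not in row 0).
row-raise-sink : ∀ {n} (H : Strip n) i → 1 ≤ row H i → ∀ k →
                 row (move down (move up H i) i) k ≡ row H k
row-raise-sink H i pos k with k ≟ i
... | yes refl = trans (cong suc (row-move-self up H i)) (suc-pred pos)
  where
  suc-pred : ∀ {r} → 1 ≤ r → suc (r ∸ 1) ≡ r
  suc-pred (s≤s _) = refl
... | no k≢i = row-move-other up H i k k≢i

gap : ∀ {n} → (Fin n → ℕ) → Fin n → ℤ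
gap {n} N i = sgn (+ N i - + nextVal N (suc n) i)

εAt : ∀ {n} → (Fin n → ℕ) → Fin n → ℕ → ℤ
εAt N i r = gap N i * negOnePow r

ε-move-other : ∀ {n} d (H : Strip n) i j → j ≢ i → ε (move d H i) j ≡ ε H j
ε-move-other d H i j j≢i = cong (εAt (num H) j) (row-move-other d H i j j≢i)

-- Moving σᵢ (out of row 0, if upward) negates εᵢ.
ε-move-self : ∀ {n} d (H : Strip n) i {u} → 1 ≤ row H i → ε H i ≡ u → ε (move d H i) i ≡ - u
ε-move-self d H i pos e = trans (cong (εAt (num H) i) (row-move-self d H i)) (flip d pos e)
  where
  flip : ∀ d {r u} → 1 ≤ r → εAt (num H) i r ≡ u → εAt (num H) i (moveRow d r) ≡ - u
  flip up   {suc r} _ e = sign-pred (gap (num H) i) r e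
  flip down {r}     _ e = sign-succ (gap (num H) i) r e

moveable-sign : ∀ {n} {a : Fin n → ℕ} {H i} d → MoveableIn a H i d → ε H i ≡ assignedSign d
moveable-sign up   e       = e
moveable-sign down (e , _) = e

ε-adjacent : ∀ {n} (H : Strip n) d {i j} → Adjacent i j → ε H i ≡ assignedSign d →
             AssignedOrder d (row H i) (num H i) (num H j)
ε-adjacent {n} H d {i} adj e =
  ordered-of-sign d (row H i) (num H i) _
    (subst (λ v → sgn (+ num H i - + v) * negOnePow (row H i) ≡ _) (nextVal-adjacent (num H) (suc n) adj) e)

-- Sinking σⱼ (j ≠ i) commutes with moving σᵢ in its assigned direction d, as
-- far as validity is concerned: either order of the two moves is valid iff
-- the other is, given the strip obtained after the single move.
module _ {n} {a : Fin n → ℕ} (H : Strip n) (i : Fin n) (d : Dir)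
         (sign : ε H i ≡ assignedSign d) {j : Fin n} (j≢i : j ≢ i) where

  private
    i≢j : i ≢ j
    i≢j i≡j = j≢i (sym i≡j)

  sink-after-move : Valid a (move d H i) → Valid a (move down H j) →
                    Valid a (move down (move d H i) j)
  sink-after-move V′ Vj =
    valid-spliced i≢j (row-move-other down (move d H i) j) (row-move-commute d H i j) V′ Vj adj-ij adj-ji
    where
    R : Fin n → ℕ
    R = row (move down (move d H i) j)
    Ri : R i ≡ row (move d H i) i
    Ri = row-move-other down (move d H i) j i i≢j
    Rj : R j ≡ suc (row H j)
    Rj = trans (row-move-commute d H i j j j≢i) (row-move-self down H j)
    adj-ij : Adjacent i j → Precedes (R i) (num H i) (R j) (num H j)
    adj-ij adj = from-rows R i j (trans Ri (row-move-self d H i)) Rj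
      (adjacent-after d (ε-adjacent H d adj sign)
        (consistent-at (valid⇒consistent Vj) i j (adjacent⇒< adj)
          (row-move-other down H j i i≢j) (row-move-self down H j)))
    adj-ji : Adjacent j i → Precedes (R j) (num H j) (R i) (num H i)
    adj-ji adj = from-rows R j i Rj Ri
      (precedes-lowerˡ (n≤1+n _)
        (consistent-at (valid⇒consistent V′) j i (adjacent⇒< adj) (row-move-other d H i j j≢i) refl))

  sink-before-move : Valid a H → Valid a (move down (move d H i) j) → Valid a (move down H j)
  sink-before-move V V″ =
    valid-spliced i≢j (row-move-other down H j) (λ k k≢i → sym (row-move-commute d H i j k k≢i)) V V″ adj-ij adj-ji
    where
    R : Fin n → ℕ
    R = row (move down H j)
    Ri : R i ≡ row H i
    Ri = row-move-other down H j i i≢j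
    Rj : R j ≡ suc (row H j)
    Rj = row-move-self down H j
    adj-ij : Adjacent i j → Precedes (R i) (num H i) (R j) (num H j)
    adj-ij adj = from-rows R i j Ri Rj
      (adjacent-before d (ε-adjacent H d adj sign) (valid⇒consistent V i j (adjacent⇒< adj))
        (consistent-at (valid⇒consistent V″) i j (adjacent⇒< adj)
          (trans (row-move-other down (move d H i) j i i≢j) (row-move-self d H i))
          (trans (row-move-commute d H i j j j≢i) Rj)))
    adj-ji : Adjacent j i → Precedes (R j) (num H j) (R i) (num H i)
    adj-ji adj = from-rows R j i Rj Ri (precedes-lowerˡ (n≤1+n _) (valid⇒consistent V j i (adjacent⇒< adj)))

moveable-back : ∀ {n} {a : Fin n → ℕ} {H : Strip n} {i} d → Valid a H →
                MoveableIn a H i d → MoveableIn a (move d H i) i (oppDir d)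
moveable-back {H = H} {i} d V moveable with ε-move-self d H i (Valid.row-pos V i) (moveable-sign d moveable)
moveable-back down V _ | flipped = flipped
moveable-back {a = a} {H} {i} up V _ | flipped =
  flipped
  , subst (_< height a i) (sym (row-move-self up H i)) (pred< (Valid.row-pos V i) (Valid.row-bound V i))
  , valid-resp-rows (row-raise-sink H i (Valid.row-pos V i)) V
  where
  pred< : ∀ {r h} → 1 ≤ r → r ≤ h → r ∸ 1 < h
  pred< {suc r} _ r<h = r<h

moveable-preserved : ∀ {n} {a : Fin n → ℕ} {H : Strip n} {i} d → MoveableIn a H i d →
                     Valid a (move d H i) → ∀ {j} d′ → j ≢ i →
                     MoveableIn a H j d′ → MoveableIn a (move d H i) j d′
moveable-preserved {H = H} {i} d moveable V′ {j} up j≢i e = trans (ε-move-other d H i j j≢i) e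
moveable-preserved {a = a} {H} {i} d moveable V′ {j} down j≢i (e , below , Vj) =
  trans (ε-move-other d H i j j≢i) e
  , subst (_< height a j) (sym (row-move-other d H i j j≢i)) below
  , sink-after-move H i d (moveable-sign d moveable) j≢i V′ Vj

moveable-reflected : ∀ {n} {a : Fin n → ℕ} {H : Strip n} {i} d → Valid a H → MoveableIn a H i d →
                     ∀ {j} d′ → j ≢ i → MoveableIn a (move d H i) j d′ → MoveableIn a H j d′
moveable-reflected {H = H} {i} d V moveable {j} up j≢i e = trans (sym (ε-move-other d H i j j≢i)) e
moveable-reflected {a = a} {H} {i} d V moveable {j} down j≢i (e , below , V″) =
  trans (sym (ε-move-other d H i j j≢i)) e
  , subst (_< height a j) (row-move-other d H i j j≢i) below
  , sink-before-move H i d (moveable-sign d moveable) j≢i V V″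

lemma2p2 : ∀ (n : ℕ) (a : Fin n → ℕ) → Positive a → NonDecreasing a →
    ∀ (H : Strip n) → Valid a H →
    ∀ (i : Fin n) (d : Dir) → MoveableIn a H i d →
    Valid a (move d H i) →
    MoveableIn a (move d H i) i (oppDir d)
    × (∀ (j : Fin n) (d′ : Dir) → ¬ (j ≡ i) → MoveableIn a H j d′ → MoveableIn a (move d H i) j d′)
    × (∀ (j : Fin n) → ¬ Moveable a H j → ¬ Moveable a (move d H i) j)
lemma2p2 n a _ _ H V i d moveable V′ =
  moveable-back d V moveable
  , (λ j d′ j≢i → moveable-preserved d moveable V′ d′ j≢i)
  , stuck
  where
  -- σᵢ itself is moveable in H; any other cell moveable in H′ was so in H.
  stuck : ∀ j → ¬ Moveable a H j → ¬ Moveable a (move d H i) j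
  stuck j ¬moveable (d′ , m′) with j ≟ i
  ... | yes refl = ¬moveable (d , moveable)
  ... | no j≢i   = ¬moveable (d′ , moveable-reflected d V moveable d′ j≢i m′)
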